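{- Let $r\ge 0$ be an integer, $R=2^r$, $W=\sqrt{R^2+2R}$, $\lambda=\frac{R+W}{2}$, $\mu=\frac{R-W}{2}$, and for every integer $n$ let $P_R(n)=\frac{2}{RW}(\lambda^n-\mu^n)$ and $Q_R(n)=\frac{2}{R}(\lambda^n+\mu^n)$. Then for all integers $m\ge1$ and $n\ge0$, \begin{align*} P_R(n)^{2m}&=\frac{2^{2m+1}}{R^{3m}(R+2)^m}\sum_{j=0}^{m-1}(-1)^j\binom{2m}{j}\frac{P_R(2(m-j)(n+1))}{P_R(2(m-j))}\Bigl(-\frac R2\Bigr)^{jn}\\ &\quad-\frac{2^{2m-1}}{R^{3m-1}(R+2)^m}\sum_{j=0}^{m-1}(-1)^j\binom{2m}{j}\frac{P_R(2(m-j)n)\,Q_R(2(m-j))}{P_R(2(m-j))}\Bigl(-\frac R2\Bigr)^{jn}\\ &\quad+(-1)^m\binom{2m}{m}\frac{2^{2m}}{R^{3m}(R+2)^m}\Bigl(-\frac R2\Bigr)^{mn}. \end{align*}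
   Context: $P_R(n)$ are the (shifted) generalized $r$-Pell numbers, with $P_R(0)=0$, $P_R(1)=2/R$, $P_R(2)=2$ and $2P_R(n+2)=2RP_R(n+1)+RP_R(n)$; $Q_R$ is the associated sequence, $Q_R(n)=2P_R(n+1)-RP_R(n)$. -}

module Defs where

open import Data.Nat as ℕ using (ℕ; zero; suc)
open import Data.Integer using (+_)
open import Data.Rational using (ℚ; 0ℚ; 1ℚ; _+_; _*_; _-_; -_; _/_; _÷_; ≢-nonZero)
open import Data.Rational.Properties using (_≟_)
open import Relation.Nullary using (yes; no)

ℕ→ℚ : ℕ → ℚ
ℕ→ℚ n = + n / 1

_^ℚ_ : ℚ → ℕ → ℚ
q ^ℚ zero  = 1ℚ
q ^ℚ suc n = q * (q ^ℚ n)

-- total division (x / 0 = 0); only ever applied to nonzero denominators here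
_÷'_ : ℚ → ℚ → ℚ
p ÷' q with q ≟ 0ℚ
... | yes _ = 0ℚ
... | no q≢0 = _÷_ p q {{≢-nonZero q≢0}}

Σ< : ℕ → (ℕ → ℚ) → ℚ
Σ< zero    f = 0ℚ
Σ< (suc m) f = Σ< m f + f m

Rq : ℕ → ℚ
Rq r = ℕ→ℚ (2 ℕ.^ r)

P : ℕ → ℕ → ℚ
P r zero          = 0ℚ
P r (suc zero)    = ℕ→ℚ 2 ÷' Rq r
P r (suc (suc n)) = (ℕ→ℚ 2 * Rq r * P r (suc n) + Rq r * P r n) ÷' ℕ→ℚ 2

Q : ℕ → ℕ → ℚ
Q r n = ℕ→ℚ 2 * P r (suc n) - Rq r * P r n

-- With d = R(R + 2), the numbers λ, μ = (R ± √d)/2 are the roots of x² - Rx - R/2, and the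
-- recurrences for P and Q give the Binet form λⁿ = (R/4)(Q(n) + P(n)√d).  Hence
-- λⁿ - μⁿ = (R/2) P(n) √d, λμ = -R/2 = c and λᴺ + μᴺ = (R/2) Q(N).  Expanding
-- (λⁿ - μⁿ)^2m = (λⁿ + (-μⁿ))^2m binomially and pairing the terms j and 2m - j gives
--   d^m ((R/2) P(n))^2m = Σ_{j<m} C(2m,j) (-cⁿ)^j (R/2) Q(2(m-j)n) + C(2m,m) (-cⁿ)^m,
-- and the addition formula 4 P(N + M) = R (Q(N) P(M) + P(N) Q(M)) rewrites (R/2) Q(N) as
-- 2 P(N + M)/P(M) - (R/2) P(N) Q(M)/P(M), which is the shape of the stated right-hand side.
-- The computation takes place in the ring ℚ[√d] and is read off its rational part.

module Submission where

open import Algebra.Bundles using (CommutativeMonoid; CommutativeSemiring; Ring; CommutativeRing)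
open import Algebra.Structures using (IsCommutativeRing)
open import Data.Empty using (⊥-elim)
open import Data.Fin using (toℕ)
open import Data.Integer as ℤ using (+_)
import Data.Integer.Properties as ℤ
open import Data.Nat using (ℕ; _∸_)
open import Data.Nat as ℕ using (zero; suc; _<_)
import Data.Nat.Properties as ℕ
import Data.Nat.Coprimality as Coprime
open import Data.Nat.Combinatorics using (_C_; nCk≡nC[n∸k])
open import Data.Nat.Tactic.RingSolver using (solve-∀)
open import Data.Product using (_,_)
open import Relation.Binary.PropositionalEquality using (_≡_)
import Relation.Binary.PropositionalEquality as ≡
open import Relation.Nullary using (yes; no)
open import Defs

2*m∸j≡j+2*[m∸j] : ∀ {m j} → j ℕ.≤ m → 2 ℕ.* m ∸ j ≡ j ℕ.+ 2 ℕ.* (m ∸ j)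
2*m∸j≡j+2*[m∸j] {m} {j} j≤m = begin
  2 ℕ.* m ∸ j                         ≡⟨ ≡.cong (λ i → 2 ℕ.* i ∸ j) (ℕ.m∸n+n≡m j≤m) ⟨
  2 ℕ.* (m ∸ j ℕ.+ j) ∸ j             ≡⟨ ≡.cong (_∸ j) (twice (m ∸ j) j) ⟩
  j ℕ.+ 2 ℕ.* (m ∸ j) ℕ.+ j ∸ j       ≡⟨ ℕ.m+n∸n≡m (j ℕ.+ 2 ℕ.* (m ∸ j)) j ⟩
  j ℕ.+ 2 ℕ.* (m ∸ j) ∎
  where
  open ≡.≡-Reasoning
  twice : ∀ t j → 2 ℕ.* (t ℕ.+ j) ≡ j ℕ.+ 2 ℕ.* t ℕ.+ j
  twice = solve-∀

2*[1+m]∸[1+j]≡1+[2*m∸j] : ∀ {m j} → j ℕ.≤ 2 ℕ.* m → 2 ℕ.* suc m ∸ suc j ≡ suc (2 ℕ.* m ∸ j)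
2*[1+m]∸[1+j]≡1+[2*m∸j] {m} {j} j≤2m =
  ≡.trans (≡.cong (_∸ suc j) (ℕ.*-suc 2 m)) (ℕ.+-∸-assoc 1 j≤2m)

module FiniteSum {c ℓ} (M : CommutativeMonoid c ℓ) where
  open CommutativeMonoid M
  open import Algebra.Properties.CommutativeSemigroup commutativeSemigroup using (xy∙z≈xz∙y)
  open import Algebra.Properties.Monoid.Sum monoid using (sum)
  open import Relation.Binary.Reasoning.Setoid setoid

  sum< : ℕ → (ℕ → Carrier) → Carrier
  sum< zero    f = ε
  sum< (suc n) f = sum< n f ∙ f n

  sum<-cong : ∀ n {f g} → (∀ {j} → j < n → f j ≈ g j) → sum< n f ≈ sum< n g
  sum<-cong zero    f≈g = refl
  sum<-cong (suc n) f≈g = ∙-cong (sum<-cong n (λ j<n → f≈g (ℕ.m<n⇒m<1+n j<n))) (f≈g ℕ.≤-refl)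

  sum<-shift : ∀ n f → sum< (suc n) f ≈ f 0 ∙ sum< n (λ j → f (suc j))
  sum<-shift zero    f = trans (identityˡ (f 0)) (sym (identityʳ (f 0)))
  sum<-shift (suc n) f = trans (∙-congʳ (sum<-shift n f)) (assoc (f 0) _ _)

  sum≈sum< : ∀ n f → sum {n} (λ i → f (toℕ i)) ≈ sum< n f
  sum≈sum< zero    f = refl
  sum≈sum< (suc n) f = trans (∙-congˡ (sum≈sum< n (λ j → f (suc j)))) (sym (sum<-shift n f))

  -- Induction on m, removing the outermost pair F 0, F (2m) at each step.
  sum<-pairUp : ∀ m F → sum< (suc (2 ℕ.* m)) F ≈ sum< m (λ j → F j ∙ F (2 ℕ.* m ∸ j)) ∙ F m
  sum<-pairUp zero    F = refl
  sum<-pairUp (suc m) F = begin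
    sum< (suc (2 ℕ.* suc m)) F
      ≡⟨ ≡.cong (λ k → sum< (suc k) F) (ℕ.*-suc 2 m) ⟩
    sum< (suc (suc (2 ℕ.* m))) F ∙ F (suc (suc (2 ℕ.* m)))
      ≈⟨ ∙-congʳ (sum<-shift (suc (2 ℕ.* m)) F) ⟩
    F 0 ∙ sum< (suc (2 ℕ.* m)) G ∙ F (2 ℕ.+ 2 ℕ.* m)
      ≈⟨ ∙-congʳ (∙-congˡ (sum<-pairUp m G)) ⟩
    F 0 ∙ (sum< m (λ j → G j ∙ G (2 ℕ.* m ∸ j)) ∙ G m) ∙ F (2 ℕ.+ 2 ℕ.* m)
      ≈⟨ xy∙z≈xz∙y (F 0) _ _ ⟩
    F 0 ∙ F (2 ℕ.+ 2 ℕ.* m) ∙ (sum< m (λ j → G j ∙ G (2 ℕ.* m ∸ j)) ∙ G m)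
      ≈⟨ assoc _ _ _ ⟨
    F 0 ∙ F (2 ℕ.+ 2 ℕ.* m) ∙ sum< m (λ j → G j ∙ G (2 ℕ.* m ∸ j)) ∙ G m
      ≈⟨ ∙-congʳ (∙-cong (∙-congˡ (reflexive (≡.cong F (≡.sym (ℕ.*-suc 2 m))))) (sum<-cong m (λ j<m → ∙-congˡ (reflexive (≡.cong F (≡.sym (mirror j<m))))))) ⟩
    F 0 ∙ F (2 ℕ.* suc m) ∙ sum< m (λ j → G j ∙ F (2 ℕ.* suc m ∸ suc j)) ∙ G m
      ≈⟨ ∙-congʳ (sum<-shift m (λ j → F j ∙ F (2 ℕ.* suc m ∸ j))) ⟨
    sum< (suc m) (λ j → F j ∙ F (2 ℕ.* suc m ∸ j)) ∙ F (suc m) ∎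
    where
    G : ℕ → Carrier
    G j = F (suc j)
    mirror : ∀ {j} → j < m → 2 ℕ.* suc m ∸ suc j ≡ suc (2 ℕ.* m ∸ j)
    mirror j<m = 2*[1+m]∸[1+j]≡1+[2*m∸j] (ℕ.≤-trans (ℕ.<⇒≤ j<m) (ℕ.m≤n*m m 2))

module EvenBinomial {c ℓ} (S : CommutativeSemiring c ℓ) where
  open CommutativeSemiring S
  open import Algebra.Properties.Semiring.Exp semiring public using (_^_; ^-homo-*; ^-assocʳ)
  open import Algebra.Properties.CommutativeSemiring.Exp S public using (^-distrib-*)
  open import Algebra.Properties.CommutativeMonoid.Mult +-commutativeMonoid public using (_×_)
  open import Algebra.Properties.CommutativeMonoid.Mult +-commutativeMonoid using (×-distrib-+; ×-congʳ)
  open import Algebra.Properties.CommutativeSemiring.Binomial S using (theorem; binomialExpansion)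
  open FiniteSum +-commutativeMonoid public
  open import Relation.Binary.Reasoning.Setoid setoid

  x^j*y^[j+k]+x^[j+k]*y^j≈[xy]^j*[x^k+y^k] : ∀ x y j k →
    x ^ j * y ^ (j ℕ.+ k) + x ^ (j ℕ.+ k) * y ^ j ≈ (x * y) ^ j * (x ^ k + y ^ k)
  x^j*y^[j+k]+x^[j+k]*y^j≈[xy]^j*[x^k+y^k] x y j k = begin
    x ^ j * y ^ (j ℕ.+ k) + x ^ (j ℕ.+ k) * y ^ j
      ≈⟨ +-cong (*-congˡ (^-homo-* y j k)) (*-congʳ (^-homo-* x j k)) ⟩
    a * (b * v) + a * u * b
      ≈⟨ +-cong (sym (*-assoc a b v)) (trans (*-assoc a u b) (*-congˡ (*-comm u b))) ⟩
    a * b * v + a * (b * u)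
      ≈⟨ +-comm _ _ ⟩
    a * (b * u) + a * b * v
      ≈⟨ +-congʳ (*-assoc a b u) ⟨
    a * b * u + a * b * v
      ≈⟨ distribˡ (a * b) u v ⟨
    a * b * (u + v)
      ≈⟨ *-congʳ (^-distrib-* x y j) ⟨
    (x * y) ^ j * (x ^ k + y ^ k) ∎
    where
    a = x ^ j
    b = y ^ j
    u = x ^ k
    v = y ^ k

  binomial-even : ∀ m x y → (x + y) ^ (2 ℕ.* m) ≈
    sum< m (λ j → (2 ℕ.* m C j) × ((x * y) ^ j * (x ^ (2 ℕ.* (m ∸ j)) + y ^ (2 ℕ.* (m ∸ j)))))
      + (2 ℕ.* m C m) × (x * y) ^ m
  binomial-even m x y = begin
    (x + y) ^ N                             ≈⟨ theorem N x y ⟩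
    binomialExpansion x y N                 ≈⟨ sum≈sum< (suc N) F ⟩
    sum< (suc N) F                          ≈⟨ sum<-pairUp m F ⟩
    sum< m (λ j → F j + F (N ∸ j)) + F m    ≈⟨ +-cong (sum<-cong m pair) middle ⟩
    sum< m (λ j → (N C j) × ((x * y) ^ j * (x ^ (2 ℕ.* (m ∸ j)) + y ^ (2 ℕ.* (m ∸ j))))) + (N C m) × (x * y) ^ m ∎
    where
    N = 2 ℕ.* m
    F : ℕ → Carrier
    F i = (N C i) × (x ^ i * y ^ (N ∸ i))
    N∸m≡m : N ∸ m ≡ m
    N∸m≡m = ≡.trans (ℕ.m+n∸m≡n m (m ℕ.+ 0)) (ℕ.+-identityʳ m)
    middle : F m ≈ (N C m) × (x * y) ^ m
    middle = ×-congʳ (N C m) (trans (reflexive (≡.cong (λ e → x ^ m * y ^ e) N∸m≡m)) (sym (^-distrib-* x y m)))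
    pair : ∀ {j} → j < m → F j + F (N ∸ j) ≈ (N C j) × ((x * y) ^ j * (x ^ (2 ℕ.* (m ∸ j)) + y ^ (2 ℕ.* (m ∸ j))))
    pair {j} j<m = begin
      F j + F (N ∸ j)
        ≡⟨ ≡.cong₂ (λ c e → F j + c × (x ^ (N ∸ j) * y ^ e)) (≡.sym (nCk≡nC[n∸k] j≤N)) (ℕ.m∸[m∸n]≡n j≤N) ⟩
      (N C j) × (x ^ j * y ^ (N ∸ j)) + (N C j) × (x ^ (N ∸ j) * y ^ j)
        ≈⟨ ×-distrib-+ _ _ (N C j) ⟨
      (N C j) × (x ^ j * y ^ (N ∸ j) + x ^ (N ∸ j) * y ^ j)
        ≡⟨ ≡.cong (λ e → (N C j) × (x ^ j * y ^ e + x ^ e * y ^ j)) N∸j≡j+k ⟩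
      (N C j) × (x ^ j * y ^ (j ℕ.+ k) + x ^ (j ℕ.+ k) * y ^ j)
        ≈⟨ ×-congʳ (N C j) (x^j*y^[j+k]+x^[j+k]*y^j≈[xy]^j*[x^k+y^k] x y j k) ⟩
      (N C j) × ((x * y) ^ j * (x ^ k + y ^ k)) ∎
      where
      k = 2 ℕ.* (m ∸ j)
      j≤m = ℕ.<⇒≤ j<m
      j≤N : j ℕ.≤ N
      j≤N = ℕ.≤-trans j≤m (ℕ.m≤n*m m 2)
      N∸j≡j+k : N ∸ j ≡ j ℕ.+ k
      N∸j≡j+k = 2*m∸j≡j+2*[m∸j] j≤m

module RingPower {c ℓ} (R : Ring c ℓ) where
  open Ring R
  open import Algebra.Properties.Ring R using (-‿distribˡ-*; -‿distribʳ-*)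
  open import Algebra.Properties.AbelianGroup +-abelianGroup using (⁻¹-involutive)
  open import Algebra.Properties.Semiring.Exp semiring using (_^_; ^-congˡ; ^-assocʳ)
  open import Relation.Binary.Reasoning.Setoid setoid

  [-x]^[2k]≈x^[2k] : ∀ x k → (- x) ^ (2 ℕ.* k) ≈ x ^ (2 ℕ.* k)
  [-x]^[2k]≈x^[2k] x k = begin
    (- x) ^ (2 ℕ.* k)    ≈⟨ ^-assocʳ (- x) 2 k ⟨
    ((- x) ^ 2) ^ k      ≈⟨ ^-congˡ k square ⟩
    (x ^ 2) ^ k          ≈⟨ ^-assocʳ x 2 k ⟩
    x ^ (2 ℕ.* k) ∎
    where
    square : (- x) ^ 2 ≈ x ^ 2
    square = begin
      - x * (- x * 1#)   ≈⟨ *-congˡ (-‿distribˡ-* x 1#) ⟨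
      - x * - (x * 1#)   ≈⟨ -‿distribʳ-* (- x) (x * 1#) ⟨
      - (- x * (x * 1#)) ≈⟨ -‿cong (-‿distribˡ-* x (x * 1#)) ⟨
      - - (x * (x * 1#)) ≈⟨ ⁻¹-involutive _ ⟩
      x * (x * 1#) ∎

-- Opened only now: its operators would clash with those of the algebraic bundles above.
open import Data.Rational using (ℚ; _+_; _*_; _-_; -_)
open import Data.Rational using (0ℚ; 1ℚ; ½; mkℚ; Positive; NonNegative; 1/_; ≢-nonZero)
import Data.Rational.Properties as ℚ
open import Data.Rational.Solver using (module +-*-Solver)
import Data.Rational.Unnormalised as ℚᵘ
import Data.Rational.Unnormalised.Properties as ℚᵘ

module RationalFacts where
  open ≡ using (_≢_; refl; sym; trans; cong; cong₂; module ≡-Reasoning)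
  open +-*-Solver
  open import Algebra.Properties.Semiring.Exp (CommutativeRing.semiring ℚ.+-*-commutativeRing) using (_^_; ^-assocʳ)
  open import Algebra.Properties.CommutativeSemiring.Exp (CommutativeRing.commutativeSemiring ℚ.+-*-commutativeRing) using (^-distrib-*)

  ℕ→ℚ-suc : ∀ n → ℕ→ℚ (suc n) ≡ 1ℚ + ℕ→ℚ n
  ℕ→ℚ-suc n = begin
    ℕ→ℚ (suc n)                   ≡⟨ ℚ.normalize-coprime (Coprime.sym (Coprime.1-coprimeTo (suc n))) ⟩
    mkℚ (+ suc n) 0 _             ≡⟨ ℚ.toℚᵘ-injective (ℚᵘ.≃-trans (ℚᵘ.*≡* eq) (ℚᵘ.≃-sym (ℚ.toℚᵘ-homo-+ 1ℚ q))) ⟩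
    1ℚ + q                        ≡⟨ cong (_+_ 1ℚ) (ℚ.normalize-coprime (Coprime.sym (Coprime.1-coprimeTo n))) ⟨
    1ℚ + ℕ→ℚ n ∎
    where
    open ≡-Reasoning
    q = mkℚ (+ n) 0 (Coprime.sym (Coprime.1-coprimeTo n))
    eq : + suc n ℤ.* + 1 ≡ (+ 1 ℤ.* + 1 ℤ.+ + n ℤ.* + 1) ℤ.* + 1
    eq = cong (ℤ._* + 1) (trans (ℤ.pos-+ 1 n) (cong (ℤ._+_ (+ 1)) (sym (ℤ.*-identityʳ (+ n)))))

  pos⇒≢0 : ∀ p → Positive p → p ≢ 0ℚ
  pos⇒≢0 p p>0 p≡0 = ℚ.<⇒≢ (ℚ.positive⁻¹ p {{p>0}}) (sym p≡0)

  p÷'q*q≡p : ∀ p {q} → q ≢ 0ℚ → (p ÷' q) * q ≡ p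
  p÷'q*q≡p p {q} q≢0 with q ℚ.≟ 0ℚ
  ... | yes q≡0 = ⊥-elim (q≢0 q≡0)
  ... | no  q≢0 = trans (ℚ.*-assoc p _ q) (trans (cong (p *_) (ℚ.*-inverseˡ q {{≢-nonZero q≢0}})) (ℚ.*-identityʳ p))

  ÷'-unique : ∀ {p q z} → q ≢ 0ℚ → z * q ≡ p → p ÷' q ≡ z
  ÷'-unique {p} {q} {z} q≢0 z*q≡p with q ℚ.≟ 0ℚ
  ... | yes q≡0 = ⊥-elim (q≢0 q≡0)
  ... | no  q≢0 = begin
    p * 1/ q           ≡⟨ cong (_* 1/ q) z*q≡p ⟨
    z * q * 1/ q       ≡⟨ ℚ.*-assoc z q _ ⟩
    z * (q * 1/ q)     ≡⟨ cong (z *_) (ℚ.*-inverseʳ q) ⟩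
    z * 1ℚ             ≡⟨ ℚ.*-identityʳ z ⟩
    z ∎
    where
    open ≡-Reasoning
    instance _ = ≢-nonZero q≢0

  *-cancelʳ-≡ : ∀ {p p′ q} → q ≢ 0ℚ → p * q ≡ p′ * q → p ≡ p′
  *-cancelʳ-≡ q≢0 eq = trans (sym (÷'-unique q≢0 eq)) (÷'-unique q≢0 refl)

  ÷'-pos : ∀ p q → Positive p → Positive q → Positive (p ÷' q)
  ÷'-pos p q p>0 q>0 with q ℚ.≟ 0ℚ
  ... | yes q≡0 = ⊥-elim (pos⇒≢0 q q>0 q≡0)
  ... | no  q≢0 = ℚ.pos*pos⇒pos p {{p>0}} ((1/ q) {{≢-nonZero q≢0}}) {{ℚ.1/pos⇒pos q {{q>0}}}}

  p÷'2≡p*½ : ∀ p → p ÷' ℕ→ℚ 2 ≡ p * ½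
  p÷'2≡p*½ p = ÷'-unique (λ ()) (solve 1 (λ p → p :* con ½ :* con (ℕ→ℚ 2) := p) refl p)

  ^ℚ-pos : ∀ {q} n → Positive q → Positive (q ^ℚ n)
  ^ℚ-pos zero    q>0 = _
  ^ℚ-pos {q} (suc n) q>0 = ℚ.pos*pos⇒pos q {{q>0}} (q ^ℚ n) {{^ℚ-pos n q>0}}

  ^ℚ≡^ : ∀ q n → q ^ℚ n ≡ q ^ n
  ^ℚ≡^ q zero    = refl
  ^ℚ≡^ q (suc n) = cong (q *_) (^ℚ≡^ q n)

  ^ℚ-distrib-* : ∀ p q n → (p * q) ^ℚ n ≡ p ^ℚ n * q ^ℚ n
  ^ℚ-distrib-* p q n = begin
    (p * q) ^ℚ n       ≡⟨ ^ℚ≡^ (p * q) n ⟩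
    (p * q) ^ n        ≡⟨ ^-distrib-* p q n ⟩
    p ^ n * q ^ n      ≡⟨ cong₂ _*_ (^ℚ≡^ p n) (^ℚ≡^ q n) ⟨
    p ^ℚ n * q ^ℚ n ∎
    where open ≡-Reasoning

  ^ℚ-assocʳ : ∀ q m n → (q ^ℚ m) ^ℚ n ≡ q ^ℚ (m ℕ.* n)
  ^ℚ-assocʳ q m n = begin
    (q ^ℚ m) ^ℚ n      ≡⟨ ^ℚ≡^ (q ^ℚ m) n ⟩
    (q ^ℚ m) ^ n       ≡⟨ cong (_^ n) (^ℚ≡^ q m) ⟩
    (q ^ m) ^ n        ≡⟨ ^-assocʳ q m n ⟩
    q ^ (m ℕ.* n)      ≡⟨ ^ℚ≡^ q (m ℕ.* n) ⟨
    q ^ℚ (m ℕ.* n) ∎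
    where open ≡-Reasoning

  [-qⁿ]^j≡[-1]^j*q^[jn] : ∀ q n j → (- (q ^ℚ n)) ^ℚ j ≡ (- ℕ→ℚ 1) ^ℚ j * q ^ℚ (j ℕ.* n)
  [-qⁿ]^j≡[-1]^j*q^[jn] q n j = begin
    (- (q ^ℚ n)) ^ℚ j                      ≡⟨ cong (_^ℚ j) (solve 1 (λ x → :- x := :- con 1ℚ :* x) refl (q ^ℚ n)) ⟩
    (- ℕ→ℚ 1 * q ^ℚ n) ^ℚ j                ≡⟨ ^ℚ-distrib-* (- ℕ→ℚ 1) (q ^ℚ n) j ⟩
    (- ℕ→ℚ 1) ^ℚ j * (q ^ℚ n) ^ℚ j         ≡⟨ cong ((- ℕ→ℚ 1) ^ℚ j *_) (trans (^ℚ-assocʳ q n j) (cong (q ^ℚ_) (ℕ.*-comm n j))) ⟩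
    (- ℕ→ℚ 1) ^ℚ j * q ^ℚ (j ℕ.* n) ∎
    where open ≡-Reasoning

  Σ<-cong : ∀ n {f g : ℕ → ℚ} → (∀ {j} → j < n → f j ≡ g j) → Σ< n f ≡ Σ< n g
  Σ<-cong zero    f≡g = refl
  Σ<-cong (suc n) f≡g = cong₂ _+_ (Σ<-cong n (λ j<n → f≡g (ℕ.m<n⇒m<1+n j<n))) (f≡g ℕ.≤-refl)

  Σ<-linear : ∀ n a b f g → a * Σ< n f - b * Σ< n g ≡ Σ< n (λ j → a * f j - b * g j)
  Σ<-linear zero    a b f g = solve 2 (λ a b → a :* con 0ℚ :- b :* con 0ℚ := con 0ℚ) refl a b
  Σ<-linear (suc n) a b f g = begin
    a * (Σ< n f + f n) - b * (Σ< n g + g n)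
      ≡⟨ solve 6 (λ a b s t u v → a :* (s :+ u) :- b :* (t :+ v) := (a :* s :- b :* t) :+ (a :* u :- b :* v))
               refl a b (Σ< n f) (Σ< n g) (f n) (g n) ⟩
    (a * Σ< n f - b * Σ< n g) + (a * f n - b * g n)
      ≡⟨ cong (_+ (a * f n - b * g n)) (Σ<-linear n a b f g) ⟩
    Σ< n (λ j → a * f j - b * g j) + (a * f n - b * g n) ∎
    where open ≡-Reasoning

module QuadraticExtension (d : ℚ) where
  open +-*-Solver
  open ≡ using (refl; sym; trans; cong; cong₂; isEquivalence; module ≡-Reasoning)
  open RationalFacts using (ℕ→ℚ-suc)

  -- ⟨ a , b ⟩ stands for a + b √d.
  record ℚ[√d] : Set where
    constructor ⟨_,_⟩
    field
      re im : ℚ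
  open ℚ[√d] public

  infixl 6 _⊕_
  infixl 7 _⊗_
  infix  8 ⊖_

  _⊕_ : ℚ[√d] → ℚ[√d] → ℚ[√d]
  ⟨ a , b ⟩ ⊕ ⟨ a′ , b′ ⟩ = ⟨ a + a′ , b + b′ ⟩

  _⊗_ : ℚ[√d] → ℚ[√d] → ℚ[√d]
  ⟨ a , b ⟩ ⊗ ⟨ a′ , b′ ⟩ = ⟨ a * a′ + d * (b * b′) , a * b′ + b * a′ ⟩

  ⊖_ : ℚ[√d] → ℚ[√d]
  ⊖ ⟨ a , b ⟩ = ⟨ - a , - b ⟩

  𝟘 𝟙 : ℚ[√d]
  𝟘 = ⟨ 0ℚ , 0ℚ ⟩
  𝟙 = ⟨ 1ℚ , 0ℚ ⟩

  private
    ⊕-assoc : ∀ x y z → (x ⊕ y) ⊕ z ≡ x ⊕ (y ⊕ z)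
    ⊕-assoc ⟨ a , b ⟩ ⟨ a′ , b′ ⟩ ⟨ a″ , b″ ⟩ = cong₂ ⟨_,_⟩ (ℚ.+-assoc a a′ a″) (ℚ.+-assoc b b′ b″)

    ⊕-comm : ∀ x y → x ⊕ y ≡ y ⊕ x
    ⊕-comm ⟨ a , b ⟩ ⟨ a′ , b′ ⟩ = cong₂ ⟨_,_⟩ (ℚ.+-comm a a′) (ℚ.+-comm b b′)

    ⊕-identityˡ : ∀ x → 𝟘 ⊕ x ≡ x
    ⊕-identityˡ ⟨ a , b ⟩ = cong₂ ⟨_,_⟩ (ℚ.+-identityˡ a) (ℚ.+-identityˡ b)

    ⊕-identityʳ : ∀ x → x ⊕ 𝟘 ≡ x
    ⊕-identityʳ ⟨ a , b ⟩ = cong₂ ⟨_,_⟩ (ℚ.+-identityʳ a) (ℚ.+-identityʳ b)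

    ⊖-inverseˡ : ∀ x → ⊖ x ⊕ x ≡ 𝟘
    ⊖-inverseˡ ⟨ a , b ⟩ = cong₂ ⟨_,_⟩ (ℚ.+-inverseˡ a) (ℚ.+-inverseˡ b)

    ⊖-inverseʳ : ∀ x → x ⊕ ⊖ x ≡ 𝟘
    ⊖-inverseʳ ⟨ a , b ⟩ = cong₂ ⟨_,_⟩ (ℚ.+-inverseʳ a) (ℚ.+-inverseʳ b)

    ⊗-comm : ∀ x y → x ⊗ y ≡ y ⊗ x
    ⊗-comm ⟨ a , b ⟩ ⟨ a′ , b′ ⟩ = cong₂ ⟨_,_⟩
      (cong₂ _+_ (ℚ.*-comm a a′) (cong (d *_) (ℚ.*-comm b b′)))
      (trans (ℚ.+-comm (a * b′) (b * a′)) (cong₂ _+_ (ℚ.*-comm b a′) (ℚ.*-comm a b′)))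

    ⊗-assoc : ∀ x y z → (x ⊗ y) ⊗ z ≡ x ⊗ (y ⊗ z)
    ⊗-assoc ⟨ a , b ⟩ ⟨ a′ , b′ ⟩ ⟨ a″ , b″ ⟩ = cong₂ ⟨_,_⟩
      (solve 7 (λ a b a′ b′ a″ b″ d → (a :* a′ :+ d :* (b :* b′)) :* a″ :+ d :* ((a :* b′ :+ b :* a′) :* b″)
                                    := a :* (a′ :* a″ :+ d :* (b′ :* b″)) :+ d :* (b :* (a′ :* b″ :+ b′ :* a″)))
         refl a b a′ b′ a″ b″ d)
      (solve 7 (λ a b a′ b′ a″ b″ d → (a :* a′ :+ d :* (b :* b′)) :* b″ :+ (a :* b′ :+ b :* a′) :* a″
                                    := a :* (a′ :* b″ :+ b′ :* a″) :+ b :* (a′ :* a″ :+ d :* (b′ :* b″)))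
         refl a b a′ b′ a″ b″ d)

    ⊗-identityˡ : ∀ x → 𝟙 ⊗ x ≡ x
    ⊗-identityˡ ⟨ a , b ⟩ = cong₂ ⟨_,_⟩
      (solve 3 (λ a b d → con 1ℚ :* a :+ d :* (con 0ℚ :* b) := a) refl a b d)
      (solve 2 (λ a b → con 1ℚ :* b :+ con 0ℚ :* a := b) refl a b)

    ⊗-distribˡ : ∀ x y z → x ⊗ (y ⊕ z) ≡ x ⊗ y ⊕ x ⊗ z
    ⊗-distribˡ ⟨ a , b ⟩ ⟨ a′ , b′ ⟩ ⟨ a″ , b″ ⟩ = cong₂ ⟨_,_⟩
      (solve 7 (λ a b a′ b′ a″ b″ d → a :* (a′ :+ a″) :+ d :* (b :* (b′ :+ b″))
                                    := (a :* a′ :+ d :* (b :* b′)) :+ (a :* a″ :+ d :* (b :* b″)))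
         refl a b a′ b′ a″ b″ d)
      (solve 6 (λ a b a′ b′ a″ b″ → a :* (b′ :+ b″) :+ b :* (a′ :+ a″)
                                  := (a :* b′ :+ b :* a′) :+ (a :* b″ :+ b :* a″))
         refl a b a′ b′ a″ b″)

  isCommutativeRing : IsCommutativeRing _≡_ _⊕_ _⊗_ ⊖_ 𝟘 𝟙
  isCommutativeRing = record
    { isRing = record
      { +-isAbelianGroup = record
        { isGroup = record
          { isMonoid = record
            { isSemigroup = record
              { isMagma = record { isEquivalence = isEquivalence ; ∙-cong = cong₂ _⊕_ }
              ; assoc = ⊕-assoc }
            ; identity = ⊕-identityˡ , ⊕-identityʳ }
          ; inverse = ⊖-inverseˡ , ⊖-inverseʳ
          ; ⁻¹-cong = cong ⊖_ }
        ; comm = ⊕-comm }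
      ; *-cong = cong₂ _⊗_
      ; *-assoc = ⊗-assoc
      ; *-identity = ⊗-identityˡ , λ x → trans (⊗-comm x 𝟙) (⊗-identityˡ x)
      ; distrib = ⊗-distribˡ , λ x y z → trans (⊗-comm (y ⊕ z) x) (trans (⊗-distribˡ x y z) (cong₂ _⊕_ (⊗-comm x y) (⊗-comm x z))) }
    ; *-comm = ⊗-comm }

  commutativeRing : CommutativeRing _ _
  commutativeRing = record { isCommutativeRing = isCommutativeRing }

  open CommutativeRing commutativeRing using (ring; commutativeSemiring)
  open EvenBinomial commutativeSemiring public
  open RingPower ring public
  open import Algebra.Properties.Ring ring public using (-‿distribʳ-*)

  ι : ℚ → ℚ[√d]
  ι q = ⟨ q , 0ℚ ⟩

  conj : ℚ[√d] → ℚ[√d]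
  conj ⟨ a , b ⟩ = ⟨ a , - b ⟩

  ι-* : ∀ p q → ι p ⊗ ι q ≡ ι (p * q)
  ι-* p q = cong₂ ⟨_,_⟩
    (solve 3 (λ p q d → p :* q :+ d :* (con 0ℚ :* con 0ℚ) := p :* q) refl p q d)
    (solve 2 (λ p q → p :* con 0ℚ :+ con 0ℚ :* q := con 0ℚ) refl p q)

  ι-^ : ∀ q n → ι q ^ n ≡ ι (q ^ℚ n)
  ι-^ q zero    = refl
  ι-^ q (suc n) = trans (cong (ι q ⊗_) (ι-^ q n)) (ι-* q (q ^ℚ n))

  ×-ι : ∀ n q → n × ι q ≡ ι (ℕ→ℚ n * q)
  ×-ι zero    q = cong ι (solve 1 (λ q → con 0ℚ := con 0ℚ :* q) refl q)
  ×-ι (suc n) q = begin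
    ι q ⊕ n × ι q                ≡⟨ cong (ι q ⊕_) (×-ι n q) ⟩
    ι (q + ℕ→ℚ n * q)            ≡⟨ cong ι (solve 2 (λ q k → q :+ k :* q := (con 1ℚ :+ k) :* q) refl q (ℕ→ℚ n)) ⟩
    ι ((1ℚ + ℕ→ℚ n) * q)         ≡⟨ cong (λ k → ι (k * q)) (ℕ→ℚ-suc n) ⟨
    ι (ℕ→ℚ (suc n) * q) ∎
    where open ≡-Reasoning

  re-sum< : ∀ n F → re (sum< n F) ≡ Σ< n (λ j → re (F j))
  re-sum< zero    F = refl
  re-sum< (suc n) F = cong (_+ re (F n)) (re-sum< n F)

  conj-⊗ : ∀ x y → conj (x ⊗ y) ≡ conj x ⊗ conj y
  conj-⊗ ⟨ a , b ⟩ ⟨ a′ , b′ ⟩ = cong₂ ⟨_,_⟩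
    (solve 5 (λ a b a′ b′ d → a :* a′ :+ d :* (b :* b′) := a :* a′ :+ d :* (:- b :* :- b′)) refl a b a′ b′ d)
    (solve 4 (λ a b a′ b′ → :- (a :* b′ :+ b :* a′) := a :* :- b′ :+ :- b :* a′) refl a b a′ b′)

  conj-^ : ∀ x n → conj (x ^ n) ≡ conj x ^ n
  conj-^ x zero    = refl
  conj-^ x (suc n) = trans (conj-⊗ x (x ^ n)) (cong (conj x ⊗_) (conj-^ x n))

  ⟨0,b⟩^2≡ι[d*b*b] : ∀ b → ⟨ 0ℚ , b ⟩ ^ 2 ≡ ι (d * (b * b))
  ⟨0,b⟩^2≡ι[d*b*b] b = cong₂ ⟨_,_⟩
    (solve 2 (λ b d → con 0ℚ :* (con 0ℚ :* con 1ℚ :+ d :* (b :* con 0ℚ)) :+ d :* (b :* (con 0ℚ :* con 0ℚ :+ b :* con 1ℚ))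
                   := d :* (b :* b)) refl b d)
    (solve 2 (λ b d → con 0ℚ :* (con 0ℚ :* con 0ℚ :+ b :* con 1ℚ) :+ b :* (con 0ℚ :* con 1ℚ :+ d :* (b :* con 0ℚ))
                   := con 0ℚ) refl b d)

module Pell (r : ℕ) where
  open +-*-Solver
  open ≡ using (_≢_; refl; sym; trans; cong; cong₂; module ≡-Reasoning)
  open RationalFacts

  R two ρ d c : ℚ
  R   = Rq r
  two = ℕ→ℚ 2
  ρ   = R * ½
  d   = R * (R + two)
  c   = - (R ÷' two)

  open QuadraticExtension d

  -- The paper's λ = (R + √d)/2 and μ = (R - √d)/2.
  α β : ℚ[√d]
  α = ⟨ ρ , ½ ⟩
  β = conj α

  R-pos : Positive R
  R-pos = ℚ.normalize-pos (2 ℕ.^ r) 1 {{_}} {{ℕ.m^n≢0 2 r}}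

  ρ*½-pos : Positive (ρ * ½)
  ρ*½-pos = ℚ.pos*pos⇒pos ρ {{ℚ.pos*pos⇒pos R {{R-pos}} ½}} ½

  c≡-ρ : c ≡ - ρ
  c≡-ρ = cong -_ (p÷'2≡p*½ R)

  P-suc : ∀ n → P r (suc n) ≡ (Q r n + R * P r n) * ½
  P-suc n = solve 3 (λ p₁ p₀ R → p₁ := (con two :* p₁ :- R :* p₀ :+ R :* p₀) :* con ½) refl (P r (suc n)) (P r n) R

  Q-suc : ∀ n → Q r (suc n) ≡ (R * Q r n + d * P r n) * ½
  Q-suc n = begin
    two * P r (suc (suc n)) - R * P r (suc n)
      ≡⟨ cong (λ p → two * p - R * P r (suc n)) (p÷'2≡p*½ (two * R * P r (suc n) + R * P r n)) ⟩
    two * ((two * R * P r (suc n) + R * P r n) * ½) - R * P r (suc n)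
      ≡⟨ solve 3 (λ p₁ p₀ R → con two :* ((con two :* R :* p₁ :+ R :* p₀) :* con ½) :- R :* p₁
                          := (R :* (con two :* p₁ :- R :* p₀) :+ R :* (R :+ con two) :* p₀) :* con ½)
               refl (P r (suc n)) (P r n) R ⟩
    (R * Q r n + d * P r n) * ½ ∎
    where open ≡-Reasoning

  binet : ∀ n → α ^ n ≡ ⟨ ρ * ½ * Q r n , ρ * ½ * P r n ⟩
  binet zero = cong₂ ⟨_,_⟩ (sym (begin
      ρ * ½ * (two * (two ÷' R) - R * 0ℚ)
        ≡⟨ solve 2 (λ R t → R :* con ½ :* con ½ :* (con two :* t :- R :* con 0ℚ) := con ½ :* (t :* R)) refl R (two ÷' R) ⟩
      ½ * ((two ÷' R) * R)       ≡⟨ cong (½ *_) (p÷'q*q≡p two (pos⇒≢0 R R-pos)) ⟩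
      ½ * two                    ≡⟨⟩
      1ℚ ∎))
    (solve 1 (λ R → con 0ℚ := R :* con ½ :* con ½ :* con 0ℚ) refl R)
    where open ≡-Reasoning
  binet (suc n) = begin
    α ⊗ α ^ n                                        ≡⟨ cong (α ⊗_) (binet n) ⟩
    α ⊗ ⟨ ρ * ½ * Q r n , ρ * ½ * P r n ⟩            ≡⟨ cong₂ ⟨_,_⟩ re-step im-step ⟩
    ⟨ ρ * ½ * Q r (suc n) , ρ * ½ * P r (suc n) ⟩ ∎
    where
    open ≡-Reasoning
    re-step : ρ * (ρ * ½ * Q r n) + d * (½ * (ρ * ½ * P r n)) ≡ ρ * ½ * Q r (suc n)
    re-step = trans (solve 4 (λ R d q p → R :* con ½ :* (R :* con ½ :* con ½ :* q) :+ d :* (con ½ :* (R :* con ½ :* con ½ :* p))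
                                       := R :* con ½ :* con ½ :* ((R :* q :+ d :* p) :* con ½)) refl R d (Q r n) (P r n))
                    (cong (ρ * ½ *_) (sym (Q-suc n)))
    im-step : ρ * (ρ * ½ * P r n) + ½ * (ρ * ½ * Q r n) ≡ ρ * ½ * P r (suc n)
    im-step = trans (solve 3 (λ R q p → R :* con ½ :* (R :* con ½ :* con ½ :* p) :+ con ½ :* (R :* con ½ :* con ½ :* q)
                                     := R :* con ½ :* con ½ :* ((q :+ R :* p) :* con ½)) refl R (Q r n) (P r n))
                    (cong (ρ * ½ *_) (sym (P-suc n)))

  binet-conj : ∀ n → β ^ n ≡ ⟨ ρ * ½ * Q r n , - (ρ * ½ * P r n) ⟩
  binet-conj n = trans (sym (conj-^ α n)) (cong conj (binet n))

  α^n⊕β^n : ∀ n → α ^ n ⊕ β ^ n ≡ ι (ρ * Q r n)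
  α^n⊕β^n n = trans (cong₂ _⊕_ (binet n) (binet-conj n)) (cong₂ ⟨_,_⟩
    (solve 2 (λ R q → R :* con ½ :* con ½ :* q :+ R :* con ½ :* con ½ :* q := R :* con ½ :* q) refl R (Q r n))
    (solve 2 (λ R p → R :* con ½ :* con ½ :* p :+ :- (R :* con ½ :* con ½ :* p) := con 0ℚ) refl R (P r n)))

  α^n⊖β^n : ∀ n → α ^ n ⊕ ⊖ (β ^ n) ≡ ⟨ 0ℚ , ρ * P r n ⟩
  α^n⊖β^n n = trans (cong₂ (λ x y → x ⊕ ⊖ y) (binet n) (binet-conj n)) (cong₂ ⟨_,_⟩
    (solve 2 (λ R q → R :* con ½ :* con ½ :* q :+ :- (R :* con ½ :* con ½ :* q) := con 0ℚ) refl R (Q r n))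
    (solve 2 (λ R p → R :* con ½ :* con ½ :* p :+ :- (:- (R :* con ½ :* con ½ :* p)) := R :* con ½ :* p) refl R (P r n)))

  α⊗β≡ι[c] : α ⊗ β ≡ ι c
  α⊗β≡ι[c] = cong₂ ⟨_,_⟩
    (trans (solve 1 (λ R → R :* con ½ :* (R :* con ½) :+ R :* (R :+ con two) :* (con ½ :* :- con ½) := :- (R :* con ½)) refl R)
           (sym c≡-ρ))
    (solve 1 (λ R → R :* con ½ :* :- con ½ :+ con ½ :* (R :* con ½) := con 0ℚ) refl R)

  P-+ : ∀ N M → P r (N ℕ.+ M) ≡ ρ * ½ * (Q r N * P r M + P r N * Q r M)
  P-+ N M = *-cancelʳ-≡ (pos⇒≢0 (ρ * ½) ρ*½-pos) (begin
    P r (N ℕ.+ M) * (ρ * ½)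
      ≡⟨ ℚ.*-comm (P r (N ℕ.+ M)) (ρ * ½) ⟩
    ρ * ½ * P r (N ℕ.+ M)
      ≡⟨ cong im (trans (sym (binet (N ℕ.+ M))) (trans (^-homo-* α N M) (cong₂ _⊗_ (binet N) (binet M)))) ⟩
    ρ * ½ * Q r N * (ρ * ½ * P r M) + ρ * ½ * P r N * (ρ * ½ * Q r M)
      ≡⟨ solve 5 (λ R a b a′ b′ → R :* con ½ :* con ½ :* a :* (R :* con ½ :* con ½ :* b′) :+ R :* con ½ :* con ½ :* b :* (R :* con ½ :* con ½ :* a′)
                              := R :* con ½ :* con ½ :* (a :* b′ :+ b :* a′) :* (R :* con ½ :* con ½))
               refl R (Q r N) (P r N) (Q r M) (P r M) ⟩
    ρ * ½ * (Q r N * P r M + P r N * Q r M) * (ρ * ½) ∎)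
    where open ≡-Reasoning

  P-ratio : ∀ N M → P r M ≢ 0ℚ →
            two * (P r (N ℕ.+ M) ÷' P r M) - ρ * ((P r N * Q r M) ÷' P r M) ≡ ρ * Q r N
  P-ratio N M u≢0 = *-cancelʳ-≡ u≢0 (begin
    (two * X - ρ * Y) * u
      ≡⟨ solve 4 (λ X Y u R → (con two :* X :- R :* con ½ :* Y) :* u := con two :* (X :* u) :- R :* con ½ :* (Y :* u)) refl X Y u R ⟩
    two * (X * u) - ρ * (Y * u)
      ≡⟨ cong₂ (λ a b → two * a - ρ * b) (p÷'q*q≡p _ u≢0) (p÷'q*q≡p _ u≢0) ⟩
    two * P r (N ℕ.+ M) - ρ * (P r N * Q r M)
      ≡⟨ cong (λ a → two * a - ρ * (P r N * Q r M)) (P-+ N M) ⟩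
    two * (ρ * ½ * (Q r N * u + P r N * Q r M)) - ρ * (P r N * Q r M)
      ≡⟨ solve 5 (λ R a b a′ u → con two :* (R :* con ½ :* con ½ :* (a :* u :+ b :* a′)) :- R :* con ½ :* (b :* a′)
                              := R :* con ½ :* a :* u) refl R (Q r N) (P r N) (Q r M) u ⟩
    ρ * Q r N * u ∎)
    where
    open ≡-Reasoning
    u = P r M
    X = P r (N ℕ.+ M) ÷' u
    Y = (P r N * Q r M) ÷' u

  P-nonNeg : ∀ n → NonNegative (P r n)
  P[1+n]-pos : ∀ n → Positive (P r (suc n))
  P-nonNeg zero    = _
  P-nonNeg (suc n) = ℚ.pos⇒nonNeg (P r (suc n)) {{P[1+n]-pos n}}
  P[1+n]-pos zero    = ÷'-pos two R _ R-pos
  P[1+n]-pos (suc n) = ÷'-pos (two * R * P r (suc n) + R * P r n) two (ℚ.pos+nonNeg⇒pos (two * R * P r (suc n)) {{2RP>0}} (R * P r n) {{RP≥0}}) _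
    where
    2RP>0 = ℚ.pos*pos⇒pos (two * R) {{ℚ.pos*pos⇒pos two R {{R-pos}}}} (P r (suc n)) {{P[1+n]-pos n}}
    RP≥0  = ℚ.nonNeg*nonNeg⇒nonNeg R {{ℚ.pos⇒nonNeg R {{R-pos}}}} (P r n) {{P-nonNeg n}}

  P-pos : ∀ {k} → 0 < k → Positive (P r k)
  P-pos {suc k} _ = P[1+n]-pos k

  -- (λⁿ - μⁿ)², a rational number.
  Δ² : ℕ → ℚ
  Δ² n = d * (ρ * P r n * (ρ * P r n))

  αⁿ⊗⊖βⁿ≡ι[-cⁿ] : ∀ n → α ^ n ⊗ ⊖ (β ^ n) ≡ ι (- c ^ℚ n)
  αⁿ⊗⊖βⁿ≡ι[-cⁿ] n = begin
    α ^ n ⊗ ⊖ (β ^ n)      ≡⟨ -‿distribʳ-* (α ^ n) (β ^ n) ⟨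
    ⊖ (α ^ n ⊗ β ^ n)      ≡⟨ cong ⊖_ (^-distrib-* α β n) ⟨
    ⊖ ((α ⊗ β) ^ n)        ≡⟨ cong (λ z → ⊖ (z ^ n)) α⊗β≡ι[c] ⟩
    ⊖ (ι c ^ n)            ≡⟨ cong ⊖_ (ι-^ c n) ⟩
    ι (- c ^ℚ n) ∎
    where open ≡-Reasoning

  [αⁿ]^2k⊕[⊖βⁿ]^2k≡ι[ρQ] : ∀ n k → (α ^ n) ^ (2 ℕ.* k) ⊕ (⊖ (β ^ n)) ^ (2 ℕ.* k) ≡ ι (ρ * Q r (2 ℕ.* k ℕ.* n))
  [αⁿ]^2k⊕[⊖βⁿ]^2k≡ι[ρQ] n k = begin
    (α ^ n) ^ (2 ℕ.* k) ⊕ (⊖ (β ^ n)) ^ (2 ℕ.* k)  ≡⟨ cong ((α ^ n) ^ (2 ℕ.* k) ⊕_) ([-x]^[2k]≈x^[2k] (β ^ n) k) ⟩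
    (α ^ n) ^ (2 ℕ.* k) ⊕ (β ^ n) ^ (2 ℕ.* k)      ≡⟨ cong₂ _⊕_ (^-assocʳ α n (2 ℕ.* k)) (^-assocʳ β n (2 ℕ.* k)) ⟩
    α ^ (n ℕ.* (2 ℕ.* k)) ⊕ β ^ (n ℕ.* (2 ℕ.* k))  ≡⟨ α^n⊕β^n (n ℕ.* (2 ℕ.* k)) ⟩
    ι (ρ * Q r (n ℕ.* (2 ℕ.* k)))                  ≡⟨ cong (λ i → ι (ρ * Q r i)) (ℕ.*-comm n (2 ℕ.* k)) ⟩
    ι (ρ * Q r (2 ℕ.* k ℕ.* n)) ∎
    where open ≡-Reasoning

  ι[Δ²^m]≡binomialSum : ∀ m n → ι (Δ² n ^ℚ m) ≡
    sum< m (λ j → ι (ℕ→ℚ (2 ℕ.* m C j) * ((- c ^ℚ n) ^ℚ j * (ρ * Q r (2 ℕ.* (m ∸ j) ℕ.* n)))))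
      ⊕ ι (ℕ→ℚ (2 ℕ.* m C m) * (- c ^ℚ n) ^ℚ m)
  ι[Δ²^m]≡binomialSum m n = begin
    ι (Δ² n ^ℚ m)                 ≡⟨ ι-^ (Δ² n) m ⟨
    ι (Δ² n) ^ m                  ≡⟨ cong (_^ m) (trans (cong (_^ 2) (α^n⊖β^n n)) (⟨0,b⟩^2≡ι[d*b*b] (ρ * P r n))) ⟨
    ((x ⊕ y) ^ 2) ^ m             ≡⟨ ^-assocʳ (x ⊕ y) 2 m ⟩
    (x ⊕ y) ^ (2 ℕ.* m)           ≡⟨ binomial-even m x y ⟩
    sum< m (λ j → (2 ℕ.* m C j) × ((x ⊗ y) ^ j ⊗ (x ^ (2 ℕ.* (m ∸ j)) ⊕ y ^ (2 ℕ.* (m ∸ j)))))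
      ⊕ (2 ℕ.* m C m) × (x ⊗ y) ^ m
                                  ≡⟨ cong₂ _⊕_ (sum<-cong m (λ {j} _ → term j)) last ⟩
    sum< m (λ j → ι (ℕ→ℚ (2 ℕ.* m C j) * ((- c ^ℚ n) ^ℚ j * (ρ * Q r (2 ℕ.* (m ∸ j) ℕ.* n)))))
      ⊕ ι (ℕ→ℚ (2 ℕ.* m C m) * (- c ^ℚ n) ^ℚ m) ∎
    where
    open ≡-Reasoning
    binom : ℕ → ℕ
    binom j = 2 ℕ.* m C j
    x y : ℚ[√d]
    x = α ^ n
    y = ⊖ (β ^ n)
    xy^j : ∀ j → (x ⊗ y) ^ j ≡ ι ((- c ^ℚ n) ^ℚ j)
    xy^j j = trans (cong (_^ j) (αⁿ⊗⊖βⁿ≡ι[-cⁿ] n)) (ι-^ (- c ^ℚ n) j)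
    term : ∀ j → (2 ℕ.* m C j) × ((x ⊗ y) ^ j ⊗ (x ^ (2 ℕ.* (m ∸ j)) ⊕ y ^ (2 ℕ.* (m ∸ j))))
               ≡ ι (ℕ→ℚ (2 ℕ.* m C j) * ((- c ^ℚ n) ^ℚ j * (ρ * Q r (2 ℕ.* (m ∸ j) ℕ.* n))))
    term j = begin
      binom j × ((x ⊗ y) ^ j ⊗ (x ^ (2 ℕ.* (m ∸ j)) ⊕ y ^ (2 ℕ.* (m ∸ j))))
        ≡⟨ cong (binom j ×_) (cong₂ _⊗_ (xy^j j) ([αⁿ]^2k⊕[⊖βⁿ]^2k≡ι[ρQ] n (m ∸ j))) ⟩
      binom j × (ι ((- c ^ℚ n) ^ℚ j) ⊗ ι (ρ * Q r (2 ℕ.* (m ∸ j) ℕ.* n)))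
        ≡⟨ cong (binom j ×_) (ι-* ((- c ^ℚ n) ^ℚ j) (ρ * Q r (2 ℕ.* (m ∸ j) ℕ.* n))) ⟩
      binom j × ι ((- c ^ℚ n) ^ℚ j * (ρ * Q r (2 ℕ.* (m ∸ j) ℕ.* n)))
        ≡⟨ ×-ι (binom j) _ ⟩
      ι (ℕ→ℚ (binom j) * ((- c ^ℚ n) ^ℚ j * (ρ * Q r (2 ℕ.* (m ∸ j) ℕ.* n)))) ∎
    last : (2 ℕ.* m C m) × (x ⊗ y) ^ m ≡ ι (ℕ→ℚ (2 ℕ.* m C m) * (- c ^ℚ n) ^ℚ m)
    last = trans (cong (binom m ×_) (xy^j m)) (×-ι (binom m) _)

  signedBinomial : ℕ → ℕ → ℚ
  signedBinomial m j = (- ℕ→ℚ 1) ^ℚ j * ℕ→ℚ (2 ℕ.* m C j)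

  binomial*[-cⁿ]^j : ∀ m n j → ℕ→ℚ (2 ℕ.* m C j) * (- c ^ℚ n) ^ℚ j ≡ signedBinomial m j * c ^ℚ (j ℕ.* n)
  binomial*[-cⁿ]^j m n j = trans (cong (ℕ→ℚ (2 ℕ.* m C j) *_) ([-qⁿ]^j≡[-1]^j*q^[jn] c n j))
    (solve 3 (λ b s z → b :* (s :* z) := s :* b :* z) refl (ℕ→ℚ (2 ℕ.* m C j)) ((- ℕ→ℚ 1) ^ℚ j) (c ^ℚ (j ℕ.* n)))

  lucasTerm : ℕ → ℕ → ℕ → ℚ
  lucasTerm m n j = signedBinomial m j * (ρ * Q r (2 ℕ.* (m ∸ j) ℕ.* n)) * c ^ℚ (j ℕ.* n)

  Δ²^m-expansion : ∀ m n → Δ² n ^ℚ m ≡ Σ< m (lucasTerm m n) + signedBinomial m m * c ^ℚ (m ℕ.* n)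
  Δ²^m-expansion m n = begin
    Δ² n ^ℚ m
      ≡⟨ cong re (ι[Δ²^m]≡binomialSum m n) ⟩
    re (sum< m (λ j → ι (ℕ→ℚ (2 ℕ.* m C j) * ((- c ^ℚ n) ^ℚ j * (ρ * Q r (2 ℕ.* (m ∸ j) ℕ.* n)))))) + ℕ→ℚ (2 ℕ.* m C m) * (- c ^ℚ n) ^ℚ m
      ≡⟨ cong₂ _+_ (trans (re-sum< m _) (Σ<-cong m (λ {j} _ → term j))) (binomial*[-cⁿ]^j m n m) ⟩
    Σ< m (lucasTerm m n) + signedBinomial m m * c ^ℚ (m ℕ.* n) ∎
    where
    open ≡-Reasoning
    term : ∀ j → ℕ→ℚ (2 ℕ.* m C j) * ((- c ^ℚ n) ^ℚ j * (ρ * Q r (2 ℕ.* (m ∸ j) ℕ.* n))) ≡ lucasTerm m n j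
    term j = begin
      b * (s * x)                     ≡⟨ ℚ.*-assoc b s x ⟨
      b * s * x                       ≡⟨ cong (_* x) (binomial*[-cⁿ]^j m n j) ⟩
      signedBinomial m j * z * x      ≡⟨ solve 3 (λ a z x → a :* z :* x := a :* x :* z) refl (signedBinomial m j) z x ⟩
      lucasTerm m n j ∎
      where
      b = ℕ→ℚ (2 ℕ.* m C j)
      s = (- c ^ℚ n) ^ℚ j
      x = ρ * Q r (2 ℕ.* (m ∸ j) ℕ.* n)
      z = c ^ℚ (j ℕ.* n)

  denominator : ℕ → ℚ
  denominator m = R ^ℚ (3 ℕ.* m) * (R + two) ^ℚ m

  K : ℕ → ℚ
  K m = (two ^ℚ (2 ℕ.* m)) ÷' denominator m

  R^a*[R+2]^b≢0 : ∀ a b → R ^ℚ a * (R + two) ^ℚ b ≢ 0ℚ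
  R^a*[R+2]^b≢0 a b = pos⇒≢0 _ (ℚ.pos*pos⇒pos (R ^ℚ a) {{^ℚ-pos a R-pos}} ((R + two) ^ℚ b) {{^ℚ-pos b R+2-pos}})
    where
    R+2-pos = ℚ.pos+nonNeg⇒pos R {{R-pos}} two

  P^[2m]≡K*Δ²^m : ∀ m n → P r n ^ℚ (2 ℕ.* m) ≡ K m * Δ² n ^ℚ m
  P^[2m]≡K*Δ²^m m n = *-cancelʳ-≡ (R^a*[R+2]^b≢0 (3 ℕ.* m) m) (begin
    P r n ^ℚ (2 ℕ.* m) * (R ^ℚ (3 ℕ.* m) * (R + two) ^ℚ m)
      ≡⟨ cong₂ (λ a b → a * (b * (R + two) ^ℚ m)) (^ℚ-assocʳ (P r n) 2 m) (^ℚ-assocʳ R 3 m) ⟨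
    (P r n ^ℚ 2) ^ℚ m * ((R ^ℚ 3) ^ℚ m * (R + two) ^ℚ m)
      ≡⟨ cong ((P r n ^ℚ 2) ^ℚ m *_) (^ℚ-distrib-* (R ^ℚ 3) (R + two) m) ⟨
    (P r n ^ℚ 2) ^ℚ m * (R ^ℚ 3 * (R + two)) ^ℚ m
      ≡⟨ ^ℚ-distrib-* (P r n ^ℚ 2) (R ^ℚ 3 * (R + two)) m ⟨
    (P r n ^ℚ 2 * (R ^ℚ 3 * (R + two))) ^ℚ m
      ≡⟨ cong (_^ℚ m) (solve 2 (λ p R → (p :* (p :* con 1ℚ)) :* ((R :* (R :* (R :* con 1ℚ))) :* (R :+ con two))
                                     := (con two :* (con two :* con 1ℚ)) :* ((R :* (R :+ con two)) :* (R :* con ½ :* p :* (R :* con ½ :* p))))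
                              refl (P r n) R) ⟩
    (two ^ℚ 2 * Δ² n) ^ℚ m
      ≡⟨ ^ℚ-distrib-* (two ^ℚ 2) (Δ² n) m ⟩
    (two ^ℚ 2) ^ℚ m * Δ² n ^ℚ m
      ≡⟨ cong (_* Δ² n ^ℚ m) (trans (^ℚ-assocʳ two 2 m) (sym (p÷'q*q≡p _ (R^a*[R+2]^b≢0 (3 ℕ.* m) m)))) ⟩
    K m * denominator m * Δ² n ^ℚ m
      ≡⟨ solve 3 (λ a b t → a :* b :* t := a :* t :* b) refl (K m) (denominator m) (Δ² n ^ℚ m) ⟩
    K m * Δ² n ^ℚ m * denominator m ∎)
    where open ≡-Reasoning

  leadingCoefficient : ∀ m → (two ^ℚ (2 ℕ.* m ℕ.+ 1)) ÷' denominator m ≡ two * K m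
  leadingCoefficient m = ÷'-unique (R^a*[R+2]^b≢0 (3 ℕ.* m) m) (begin
    two * K m * denominator m       ≡⟨ ℚ.*-assoc two (K m) (denominator m) ⟩
    two * (K m * denominator m)     ≡⟨ cong (two *_) (p÷'q*q≡p _ (R^a*[R+2]^b≢0 (3 ℕ.* m) m)) ⟩
    two ^ℚ suc (2 ℕ.* m)            ≡⟨ cong (two ^ℚ_) (ℕ.+-comm 1 (2 ℕ.* m)) ⟩
    two ^ℚ (2 ℕ.* m ℕ.+ 1) ∎)
    where open ≡-Reasoning

  -- Stated for suc m so that the truncated exponents 2m ∸ 1 and 3m ∸ 1 are true predecessors,
  -- and the powers in K (suc m) unfold one step definitionally.
  secondCoefficient : ∀ m → (two ^ℚ (2 ℕ.* suc m ∸ 1)) ÷' (R ^ℚ (3 ℕ.* suc m ∸ 1) * (R + two) ^ℚ suc m) ≡ K (suc m) * ρ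
  secondCoefficient m = ÷'-unique (R^a*[R+2]^b≢0 (3 ℕ.* suc m ∸ 1) (suc m)) (begin
    K (suc m) * ρ * (R ^ℚ (3 ℕ.* suc m ∸ 1) * (R + two) ^ℚ suc m)
      ≡⟨ solve 4 (λ k R a b → k :* (R :* con ½) :* (a :* b) := con ½ :* (k :* (R :* a :* b)))
               refl (K (suc m)) R (R ^ℚ (3 ℕ.* suc m ∸ 1)) ((R + two) ^ℚ suc m) ⟩
    ½ * (K (suc m) * denominator (suc m))
      ≡⟨ cong (½ *_) (p÷'q*q≡p _ (R^a*[R+2]^b≢0 (3 ℕ.* suc m) (suc m))) ⟩
    ½ * (two * two ^ℚ (2 ℕ.* suc m ∸ 1))
      ≡⟨ solve 1 (λ t → con ½ :* (con two :* t) := t) refl (two ^ℚ (2 ℕ.* suc m ∸ 1)) ⟩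
    two ^ℚ (2 ℕ.* suc m ∸ 1) ∎)
    where open ≡-Reasoning

  ratioTerm productTerm : ℕ → ℕ → ℕ → ℚ
  ratioTerm m n j =
    signedBinomial m j * (P r (2 ℕ.* (m ∸ j) ℕ.* (n ℕ.+ 1)) ÷' P r (2 ℕ.* (m ∸ j))) * c ^ℚ (j ℕ.* n)
  productTerm m n j =
    signedBinomial m j * ((P r (2 ℕ.* (m ∸ j) ℕ.* n) * Q r (2 ℕ.* (m ∸ j))) ÷' P r (2 ℕ.* (m ∸ j))) * c ^ℚ (j ℕ.* n)

  termwise : ∀ {m} n {j} → j < m → two * ratioTerm m n j - ρ * productTerm m n j ≡ lucasTerm m n j
  termwise {m} n {j} j<m = begin
    two * (s * X * z) - ρ * (s * Y * z)
      ≡⟨ solve 5 (λ s X Y z R → con two :* (s :* X :* z) :- R :* con ½ :* (s :* Y :* z)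
                              := s :* (con two :* X :- R :* con ½ :* Y) :* z) refl s X Y z R ⟩
    s * (two * X - ρ * Y) * z
      ≡⟨ cong (λ i → s * (two * (P r i ÷' P r M) - ρ * Y) * z) M*[n+1]≡M*n+M ⟩
    s * (two * (P r (M ℕ.* n ℕ.+ M) ÷' P r M) - ρ * Y) * z
      ≡⟨ cong (λ t → s * t * z) (P-ratio (M ℕ.* n) M (pos⇒≢0 _ P[M]>0)) ⟩
    lucasTerm m n j ∎
    where
    open ≡-Reasoning
    M = 2 ℕ.* (m ∸ j)
    s = signedBinomial m j
    z = c ^ℚ (j ℕ.* n)
    X = P r (M ℕ.* (n ℕ.+ 1)) ÷' P r M
    Y = (P r (M ℕ.* n) * Q r M) ÷' P r M
    M*[n+1]≡M*n+M : M ℕ.* (n ℕ.+ 1) ≡ M ℕ.* n ℕ.+ M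
    M*[n+1]≡M*n+M = trans (ℕ.*-distribˡ-+ M n 1) (cong (M ℕ.* n ℕ.+_) (ℕ.*-identityʳ M))
    P[M]>0 : Positive (P r M)
    P[M]>0 = P-pos (ℕ.<-≤-trans (ℕ.m<n⇒0<n∸m j<m) (ℕ.m≤m+n (m ∸ j) _))

mainTheorem5 : (r m n : ℕ) → m Data.Nat.≥ 1 →
  let R = Rq r
      two = ℕ→ℚ 2
      c = - (R ÷' two)
      k = λ (j : ℕ) → (- ℕ→ℚ 1) ^ℚ j * ℕ→ℚ ((2 Data.Nat.* m) C j)
  in P r n ^ℚ (2 Data.Nat.* m)
     ≡ ((two ^ℚ (2 Data.Nat.* m Data.Nat.+ 1)) ÷' ((R ^ℚ (3 Data.Nat.* m)) * ((R + two) ^ℚ m)))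
         * Σ< m (λ j → k j * (P r (2 Data.Nat.* (m ∸ j) Data.Nat.* (n Data.Nat.+ 1)) ÷' P r (2 Data.Nat.* (m ∸ j))) * (c ^ℚ (j Data.Nat.* n)))
       - ((two ^ℚ (2 Data.Nat.* m ∸ 1)) ÷' ((R ^ℚ (3 Data.Nat.* m ∸ 1)) * ((R + two) ^ℚ m)))
         * Σ< m (λ j → k j * ((P r (2 Data.Nat.* (m ∸ j) Data.Nat.* n) * Q r (2 Data.Nat.* (m ∸ j))) ÷' P r (2 Data.Nat.* (m ∸ j))) * (c ^ℚ (j Data.Nat.* n)))
       + k m * ((two ^ℚ (2 Data.Nat.* m)) ÷' ((R ^ℚ (3 Data.Nat.* m)) * ((R + two) ^ℚ m))) * (c ^ℚ (m Data.Nat.* n))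
mainTheorem5 r zero    n ()
mainTheorem5 r (suc m) n _ = ≡.sym (begin
  ((two ^ℚ (2 ℕ.* M ℕ.+ 1)) ÷' denominator M) * Σ< M (ratioTerm M n)
    - ((two ^ℚ (2 ℕ.* M ∸ 1)) ÷' (R ^ℚ (3 ℕ.* M ∸ 1) * (R + two) ^ℚ M)) * Σ< M (productTerm M n) + tail
    ≡⟨ ≡.cong₂ (λ a b → a * Σ< M (ratioTerm M n) - b * Σ< M (productTerm M n) + tail)
               (leadingCoefficient M) (secondCoefficient m) ⟩
  two * K M * Σ< M (ratioTerm M n) - K M * ρ * Σ< M (productTerm M n) + tail
    ≡⟨ solve 6 (λ k R a b s z → con two :* k :* a :- k :* (R :* con ½) :* b :+ s :* k :* z
                              := k :* ((con two :* a :- R :* con ½ :* b) :+ s :* z))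
             ≡.refl (K M) R (Σ< M (ratioTerm M n)) (Σ< M (productTerm M n)) (signedBinomial M M) (c ^ℚ (M ℕ.* n)) ⟩
  K M * (two * Σ< M (ratioTerm M n) - ρ * Σ< M (productTerm M n) + signedBinomial M M * c ^ℚ (M ℕ.* n))
    ≡⟨ ≡.cong (λ s → K M * (s + signedBinomial M M * c ^ℚ (M ℕ.* n)))
              (≡.trans (Σ<-linear M two ρ (ratioTerm M n) (productTerm M n)) (Σ<-cong M (termwise n))) ⟩
  K M * (Σ< M (lucasTerm M n) + signedBinomial M M * c ^ℚ (M ℕ.* n))
    ≡⟨ ≡.cong (K M *_) (Δ²^m-expansion M n) ⟨
  K M * Δ² n ^ℚ M
    ≡⟨ P^[2m]≡K*Δ²^m M n ⟨
  P r n ^ℚ (2 ℕ.* M) ∎)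
  where
  open Pell r
  open RationalFacts using (Σ<-linear; Σ<-cong)
  open +-*-Solver
  open ≡.≡-Reasoning
  M = suc m
  tail = signedBinomial M M * K M * c ^ℚ (M ℕ.* n)
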